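{- Let $\Sigma=(V,E,\{P_e\}_{e\in E})$ be a signature and $\delta\in\Delta(\Sigma)$. If $F'\subseteq F\subseteq E$, then each run of the canonical protocol $\mathcal{P}^\delta_F$ is also a run of the canonical protocol $\mathcal{P}^\delta_{F'}$.
   Context: A signature is $\Sigma=(V,E,\{P_e\}_{e\in E})$ with $(V,E)$ a connected undirected graph (loops and multiple edges allowed) and $\{P_e\}$ pairwise disjoint sets of propositional letters; $Inc(v)$ is the set of edges incident to $v$, $Inc(e)$ the set of endpoints of $e$, and $e\in Edge(u,u')$ means $e$ is an edge between $u$ and $u'$. $\Phi(\Sigma)$ is the least set of formulas containing $\bot$ and all letters, closed under $\to$ and $\Box_e$ ($e\in E$), with $\neg,\vee$ defined as usual. For $T\subseteq E$, $\Phi(\Sigma,T)$ is the least set containing $\bot$, $P_t$ ($t\in T$), closed under $\to$, and containing $\Box_t\phi$ for $t\in T$ and any $\phi\in\Phi(\Sigma)$. Provability $\vdash$ is in the S5-style system (propositional tautologies, Truth, Positive/Negative Introspection, Distributivity for each $\Box_e$, plus Gateway axiom $\Box_e(\phi\to\psi)\to(\phi\to\Box_g\psi)$ for $g$ a gateway between $A,B$, $e\in A$, $\phi\in\Phi(\Sigma,A)$, $\psi\in\Phi(\Sigma,B)$, where $g$ is a gateway if every path of distinct edges/vertices from an edge in $A$ to an edge in $B$ contains $g$; rules Modus Ponens and Necessitation). A set $X$ is consistent if $\bot$ is not derivable from $X$ and theorems by Modus Ponens; a maximal consistent subset of $S$ is a consistent $X\subseteq S$ with no consistent proper extension inside $S$.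 $\Delta(\Sigma)$ is the set of formulas $\delta=\bigvee_{e\in E}\delta_e$ with $\delta_e\in\Phi(\Sigma,\{e\})$ for each $e$ ($\delta$ comes with its disjuncts $\delta_e$). An edge $b$ is a bridge if $(V,E\setminus\{b\})$ is disconnected; $\mathcal{B}$ is the set of bridges. For an edge $e$ and an endpoint $v$, $C^v_{ -e}$ is the connected component of $(V,E\setminus\{e\})$ containing $v$; $h\in C^v_{ -e}$ means $h$ is an edge of it. Canonical protocol $\mathcal{P}^\delta_F$ (a protocol: sets of values $W_e$, local conditions $L_v\subseteq\prod_{e\in Inc(v)}W_e$, valuation $p^\pi\subseteq W_e$ for $p\in P_e$; a run is a choice of a value for each edge satisfying all local conditions): a value of $e\in Edge(u,u')$ is a tuple $\langle X,\{f_v\}_{v\in Inc(e)}\rangle$ with (1a) $X$ a maximal consistent subset of $\Phi(\Sigma,\{e\})$; (1b) $f_u,f_{u'}$ real numbers; (1c) $f_u+f_{u'}>0$ iff $\delta_e\in X$; if $e\in\mathcal{B}$: (2a) if $\delta_e\notin X$ then $f_u+f_{u'}=0$; (2b) for an endpoint $u$, if $f_u<0$ then $\Box_e\bigvee_{h\in C^u_{ -e}}\delta_h\in X$; (2c) if $e\in F$, $\Box_e\delta\in X$ and $\delta_e\notin X$, then $f_u<0$ or $f_{u'}<0$; if $e\in E\setminus\mathcal{B}$: (3a) if $f_u+f_{u'}<0$ then $\Box_e\delta\in X$; (3b) if $e\in F$, $\Box_e\delta\in X$ and $\delta_e\notin X$, then $f_u+f_{u'}<0$. Valuation: for $p\in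 P_e$, $p^\pi$ is the set of values of $e$ whose $X$ contains $p$. Local condition at $u$: a tuple $\langle X^e,\{f^e_v\}_{v\in Inc(e)}\rangle_{e\in Inc(u)}$ belongs to $L_u$ iff: if $\delta_e\notin X^e$ for every $e\in Inc(u)$, then $\sum_{e\in Inc(u)}f^e_u\ge0$. -}

module Defs where

open import Data.Nat using (ℕ)
open import Data.Bool using (Bool; true; false; T; _∨_)
open import Data.Unit using (⊤; tt)
open import Data.Empty using (⊥)
open import Data.Fin using (Fin; _≟_)
open import Data.Fin.Subset using (Subset; _∈_; ⁅_⁆)
open import Data.List using (List; []; _∷_; foldr; map)
open import Data.List.Membership.Propositional using () renaming (_∈_ to _∈ₗ_)
open import Data.List.Relation.Unary.Unique.Propositional using (Unique)
open import Data.Product using (Σ; _×_; _,_; proj₁; proj₂; ∃)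
open import Data.Sum using (_⊎_)
open import Relation.Nullary using (¬_)
open import Relation.Nullary.Decidable using (⌊_⌋)
open import Relation.Binary.PropositionalEquality using (_≡_; _≢_; refl)
import Data.List as L

record RealLike : Set₁ where
  field
    Carrier : Set
    0#      : Carrier
    _+_     : Carrier → Carrier → Carrier
    _<_     : Carrier → Carrier → Set
    _≤_     : Carrier → Carrier → Set

-- A signature: a finite connected graph (loops and multi-edges allowed)
-- with vertices Fin nV, edges Fin nE, each edge having two (possibly equal)
-- ends, and for every edge e a set Letter e of propositional letters
-- (the letters of different edges are disjoint by construction: a letter
-- is a pair (e , p) with p : Letter e).
record Graph : Set where
  field
    nV   : ℕ
    nE   : ℕ
    ends : Fin nE → Fin nV × Fin nV

module GraphDefs (G : Graph) where
  open Graph G public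

  V = Fin nV
  E = Fin nE

  end₁ end₂ : E → V
  end₁ e = proj₁ (ends e)
  end₂ e = proj₂ (ends e)

  isEnd : V → E → Bool
  isEnd v e = ⌊ v ≟ end₁ e ⌋ ∨ ⌊ v ≟ end₂ e ⌋

  IsEnd : V → E → Set
  IsEnd v e = T (isEnd v e)

  data Reach (A : E → Set) : V → V → Set where
    here : ∀ {v} → Reach A v v
    step : ∀ {u w x} (e : E) → A e → IsEnd u e → IsEnd w e →
           Reach A w x → Reach A u x

  Connected : (E → Set) → Set
  Connected A = ∀ u w → Reach A u w

  IsBridge : E → Set
  IsBridge b = ¬ Connected (λ g → g ≢ b)

  InComp : V → E → E → Set
  InComp v e h = h ≢ e × ∃ λ w → IsEnd w h × Reach (λ g → g ≢ e) v w

  data Path : E → E → Set where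
    one  : ∀ e → Path e e
    step : ∀ {e e' f} (v : V) → IsEnd v e → IsEnd v e' → Path e' f → Path e f

  pathEdges : ∀ {e f} → Path e f → List E
  pathEdges (one e) = e ∷ []
  pathEdges (step {e} v _ _ p) = e ∷ pathEdges p

  pathVerts : ∀ {e f} → Path e f → List V
  pathVerts (one e) = []
  pathVerts (step v _ _ p) = v ∷ pathVerts p

  Simple : ∀ {e f} → Path e f → Set
  Simple p = Unique (pathEdges p) × Unique (pathVerts p)

  Gateway : E → Subset nE → Subset nE → Set
  Gateway g A B = ∀ a b → a ∈ A → b ∈ B → (p : Path a b) → Simple p →
                  g ∈ₗ pathEdges p

record Signature : Set₁ where
  field
    graph     : Graph
    Letter    : Fin (Graph.nE graph) → Set
    connected : GraphDefs.Connected graph (λ _ → ⊤)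

module SigDefs (S : Signature) where
  open Signature S public
  open GraphDefs graph public

  infixr 5 _⇒_

  data Formula : Set where
    ⊥'  : Formula
    var : (e : E) → Letter e → Formula
    _⇒_ : Formula → Formula → Formula
    □   : E → Formula → Formula

  ¬' : Formula → Formula
  ¬' φ = φ ⇒ ⊥'

  _∨'_ : Formula → Formula → Formula
  φ ∨' ψ = ¬' φ ⇒ ψ

  ⋁ : List Formula → Formula
  ⋁ = foldr _∨'_ ⊥'

  data InΦ (Tₛ : Subset nE) : Formula → Set where
    bot : InΦ Tₛ ⊥'
    var : ∀ t p → t ∈ Tₛ → InΦ Tₛ (var t p)
    imp : ∀ {φ ψ} → InΦ Tₛ φ → InΦ Tₛ ψ → InΦ Tₛ (φ ⇒ ψ)
    box : ∀ t φ → t ∈ Tₛ → InΦ Tₛ (□ t φ)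

  -- propositional tautologies: letters and boxed formulas are atoms
  ⟦_⟧ : Formula → (Formula → Bool) → Bool
  ⟦ ⊥' ⟧ val = false
  ⟦ var e p ⟧ val = val (var e p)
  ⟦ φ ⇒ ψ ⟧ val with ⟦ φ ⟧ val
  ... | true  = ⟦ ψ ⟧ val
  ... | false = true
  ⟦ □ e φ ⟧ val = val (□ e φ)

  Tautology : Formula → Set
  Tautology φ = ∀ val → ⟦ φ ⟧ val ≡ true

  data ⊢_ : Formula → Set where
    taut  : ∀ {φ} → Tautology φ → ⊢ φ
    truth : ∀ e φ → ⊢ (□ e φ ⇒ φ)
    posI  : ∀ e φ → ⊢ (□ e φ ⇒ □ e (□ e φ))
    negI  : ∀ e φ → ⊢ (¬' (□ e φ) ⇒ □ e (¬' (□ e φ)))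
    distr : ∀ e φ ψ → ⊢ (□ e (φ ⇒ ψ) ⇒ (□ e φ ⇒ □ e ψ))
    gate  : ∀ (g e : E) (A B : Subset nE) φ ψ → Gateway g A B → e ∈ A →
            InΦ A φ → InΦ B ψ → ⊢ (□ e (φ ⇒ ψ) ⇒ (φ ⇒ □ g ψ))
    mp    : ∀ {φ ψ} → ⊢ (φ ⇒ ψ) → ⊢ φ → ⊢ ψ
    nec   : ∀ e {φ} → ⊢ φ → ⊢ □ e φ

  data _⊢ₓ_ (X : Formula → Set) : Formula → Set where
    thm : ∀ {φ} → ⊢ φ → X ⊢ₓ φ
    hyp : ∀ {φ} → X φ → X ⊢ₓ φ
    mp  : ∀ {φ ψ} → X ⊢ₓ (φ ⇒ ψ) → X ⊢ₓ φ → X ⊢ₓ ψ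

  Consistent : (Formula → Set) → Set
  Consistent X = ¬ (X ⊢ₓ ⊥')

  _⊆ₛ_ : (Formula → Set) → (Formula → Set) → Set
  X ⊆ₛ Y = ∀ φ → X φ → Y φ

  MaxConsistentIn : (Formula → Set) → (Formula → Set) → Set₁
  MaxConsistentIn Sₛ X =
    X ⊆ₛ Sₛ × Consistent X ×
    (∀ (Y : Formula → Set) → X ⊆ₛ Y → Y ⊆ₛ Sₛ → Consistent Y → Y ⊆ₛ X)

  -- δ ∈ Δ(Σ) given by its disjuncts
  IsDelta : (E → Formula) → Set
  IsDelta δₑ = ∀ e → InΦ ⁅ e ⁆ (δₑ e)

  module Canonical (R : RealLike) (δₑ : E → Formula) where
    open RealLike R

    δ : Formula
    δ = ⋁ (map δₑ (L.allFin nE))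

    T-∨ˡ : ∀ {a} b → T a → T (a ∨ b)
    T-∨ˡ {true} b _ = tt

    T-∨ʳ : ∀ a {b} → T b → T (a ∨ b)
    T-∨ʳ true  _ = tt
    T-∨ʳ false t = t

    refl-T : ∀ {n} (v : Fin n) → T ⌊ v ≟ v ⌋
    refl-T v with v ≟ v
    ... | Relation.Nullary.yes _ = tt
    ... | Relation.Nullary.no ¬p = ¬p refl

    end₁-inc : ∀ e → IsEnd (end₁ e) e
    end₁-inc e = T-∨ˡ _ (refl-T (end₁ e))

    end₂-inc : ∀ e → IsEnd (end₂ e) e
    end₂-inc e = T-∨ʳ ⌊ end₂ e ≟ end₁ e ⌋ (refl-T (end₂ e))

    record RawVal (e : E) : Set₁ where
      field
        X : Formula → Set
        f : (v : V) → IsEnd v e → Carrier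

    sumF : ∀ {e} → RawVal e → Carrier
    sumF {e} x = RawVal.f x (end₁ e) (end₁-inc e) + RawVal.f x (end₂ e) (end₂-inc e)

    -- conditions (1a)-(3b) for being a value of e in P^δ_F
    IsValue : Subset nE → (e : E) → RawVal e → Set₁
    IsValue F e x =
      MaxConsistentIn (InΦ ⁅ e ⁆) X ×
      ((0# < sumF x → X (δₑ e)) × (X (δₑ e) → 0# < sumF x)) ×
      ((IsBridge e →
          (¬ X (δₑ e) → sumF x ≡ 0#) ×
          (∀ v (p : IsEnd v e) → f v p < 0# →
             ∀ (hs : List E) → (∀ h → (h ∈ₗ hs → InComp v e h) × (InComp v e h → h ∈ₗ hs)) →
             X (□ e (⋁ (map δₑ hs)))) ×
          (e ∈ F → X (□ e δ) → ¬ X (δₑ e) →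
             (f (end₁ e) (end₁-inc e) < 0#) ⊎ (f (end₂ e) (end₂-inc e) < 0#)))
       ×
       (¬ IsBridge e →
          (sumF x < 0# → X (□ e δ)) ×
          (e ∈ F → X (□ e δ) → ¬ X (δₑ e) → sumF x < 0#)))
      where open RawVal x

    incSum : V → ((e : E) → RawVal e) → Carrier
    incSum u ρ = go (L.allFin nE)
      where
        term : (b : Bool) → (T b → Carrier) → Carrier
        term true  g = g tt
        term false _ = 0#
        go : List E → Carrier
        go [] = 0#
        go (e ∷ es) = term (isEnd u e) (RawVal.f (ρ e) u) + go es

    Local : V → ((e : E) → RawVal e) → Set
    Local u ρ = (∀ e → IsEnd u e → ¬ RawVal.X (ρ e) (δₑ e)) → 0# ≤ incSum u ρ

    IsRun : Subset nE → ((e : E) → RawVal e) → Set₁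
    IsRun F ρ = (∀ e → IsValue F e (ρ e)) × (∀ u → Local u ρ)

module Submission where

open import Defs
open import Data.Fin.Subset using (Subset; _⊆_)
open import Data.Product using (_,_)

-- The parameter F of the canonical protocol P^δ_F occurs in
-- the definition of a value of an edge e only in the hypotheses "e ∈ F" of
-- conditions (2c) and (3b); the local conditions L_u do not mention F at
-- all.  Shrinking F therefore only weakens (2c) and (3b): the set of values
-- of every edge is antitone in F (valueAntitone below), and a run of
-- P^δ_F, being a choice of values satisfying the F-independent local
-- conditions, is then a run of P^δ_{F'} for every F' ⊆ F.

module _ (S : Signature) (R : RealLike) (δₑ : SigDefs.E S → SigDefs.Formula S) where
  open SigDefs S
  open Canonical R δₑ

  valueAntitone : ∀ {F F' : Subset nE} → F' ⊆ F →
                  ∀ e (x : RawVal e) → IsValue F e x → IsValue F' e x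
  valueAntitone F'⊆F e x (maxCons , sumSign , bridgeConds , nonBridgeConds) =
    maxCons , sumSign ,
    (λ isBridge → let (zeroSum , negativeEnd , boxDelta) = bridgeConds isBridge
                  in zeroSum , negativeEnd , (λ e∈F' → boxDelta (F'⊆F e∈F'))) ,
    (λ notBridge → let (negativeSum , boxDelta) = nonBridgeConds notBridge
                   in negativeSum , (λ e∈F' → boxDelta (F'⊆F e∈F')))

lemma12 : (R : RealLike) (S : Signature)
    (δₑ : SigDefs.E S → SigDefs.Formula S) → SigDefs.IsDelta S δₑ →
    (F F' : Subset (SigDefs.nE S)) → F' ⊆ F →
    (ρ : (e : SigDefs.E S) → SigDefs.Canonical.RawVal S R δₑ e) →
    SigDefs.Canonical.IsRun S R δₑ F ρ →
    SigDefs.Canonical.IsRun S R δₑ F' ρ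
lemma12 R S δₑ _ F F' F'⊆F ρ (values , local) =
  (λ e → valueAntitone S R δₑ F'⊆F e (ρ e) (values e)) , local
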